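{- Let $G\le S_k$ be a transitive permutation group on $k$ points generated by permutations $s$ and $t$, where $t$ is an involution, $s$ has order $n$ and $st$ has order $m$, and put $r:=ts^{ -1}$. Suppose every automorphism of $G$ is induced by conjugation by some element of $S_k$. Suppose moreover that: (i) for some nonzero integer $b$ there is exactly one point $\zeta$ which is fixed by $s^bt$ but not fixed by $t$; and (ii) there is an integer $c$ such that $\zeta s^c t$ is fixed by $s$ while $\zeta t s^{ -c} t$ is not fixed by $s$ (or, alternatively, $\zeta s^c t$ is fixed by $s^2$ while $\zeta t s^{ -c}t$ is not fixed by $s^2$). Then the orientably-regular map $\mathcal{M}(G:r,s)$ is chiral.
   Context: Permutations act on the right ($\zeta g$ is the image of the point $\zeta$ under $g$) and products are composed left to right. For a finite group $G$ generated by $r,s$ with $rs$ an involution, $\mathcal{M}(G:r,s)$ denotes the orientably-regular map with orientation-preserving automorphism group $G$, in which $r$ and $s$ are one-step rotations about a face and an incident vertex; its type is $\{m,n\}$ where $m,n$ are the orders of $r,s$. It is reflexible if some group automorphism of $G$ maps $r\mapsto r^{ -1}$ and $s\mapsto s^{ -1}$, and chiral otherwise. -}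

module Defs where

open import Data.Nat using (ℕ; zero; suc; _<_)
open import Data.Integer using (ℤ; +_; -[1+_])
open import Data.Fin using (Fin)
open import Data.Fin.Permutation
  using (Permutation′; _⟨$⟩ʳ_; _≈_; id; flip; _∘ₚ_)
open import Data.Product using (Σ; ∃; _×_; _,_)
open import Data.Sum using (_⊎_)
open import Relation.Binary.PropositionalEquality using (_≡_)
open import Relation.Nullary using (¬_)

Perm : ℕ → Set
Perm k = Permutation′ k

infixl 8 _^_
_^_ : ∀ {k} → Fin k → Perm k → Fin k
ζ ^ g = g ⟨$⟩ʳ ζ

-- Products composed left to right: ζ ^ (g · h) = (ζ ^ g) ^ h.
infixl 7 _·_
_·_ : ∀ {k} → Perm k → Perm k → Perm k
g · h = g ∘ₚ h

_⁻¹ : ∀ {k} → Perm k → Perm k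
g ⁻¹ = flip g

powℕ : ∀ {k} → Perm k → ℕ → Perm k
powℕ g zero    = id
powℕ g (suc n) = g · powℕ g n

pow : ∀ {k} → Perm k → ℤ → Perm k
pow g (+ n)      = powℕ g n
pow g -[1+ n ]   = powℕ (g ⁻¹) (suc n)

HasOrder : ∀ {k} → Perm k → ℕ → Set
HasOrder g n = (0 < n) × (powℕ g n ≈ id) × (∀ j → 0 < j → j < n → ¬ (powℕ g j ≈ id))

data ⟨_,_⟩ {k} (s t : Perm k) : Perm k → Set where
  gen-id  : ⟨ s , t ⟩ id
  gen-s   : ⟨ s , t ⟩ s
  gen-t   : ⟨ s , t ⟩ t
  gen-inv : ∀ {g} → ⟨ s , t ⟩ g → ⟨ s , t ⟩ (g ⁻¹)
  gen-mul : ∀ {g h} → ⟨ s , t ⟩ g → ⟨ s , t ⟩ h → ⟨ s , t ⟩ (g · h)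
  gen-≈   : ∀ {g h} → g ≈ h → ⟨ s , t ⟩ g → ⟨ s , t ⟩ h

Transitive : ∀ {k} → (Perm k → Set) → Set
Transitive {k} G = ∀ (x y : Fin k) → ∃ λ g → G g × (x ^ g ≡ y)

record Automorphism {k} (G : Perm k → Set) : Set where
  field
    φ       : (g : Perm k) → G g → Perm k
    resp    : ∀ {g h} (p : G g) (q : G h) → g ≈ h → φ g p ≈ φ h q
    closed  : ∀ {g} (p : G g) → G (φ g p)
    hom     : ∀ {g h} (p : G g) (q : G h) (pq : G (g · h)) →
              φ (g · h) pq ≈ φ g p · φ h q
    inj     : ∀ {g h} (p : G g) (q : G h) → φ g p ≈ φ h q → g ≈ h
    surj    : ∀ {h} → G h → Σ (Perm k) λ g → Σ (G g) λ p → φ g p ≈ h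

InducedByConjugation : ∀ {k} {G : Perm k → Set} → Automorphism G → Set
InducedByConjugation {k} {G} α =
  Σ (Perm k) λ π → ∀ g (p : G g) → Automorphism.φ α g p ≈ π ⁻¹ · g · π

-- M(G : r, s) is reflexible iff some automorphism of G maps
-- r ↦ r⁻¹ and s ↦ s⁻¹; chiral otherwise.
Reflexible : ∀ {k} (G : Perm k → Set) (r s : Perm k) → G r → G s → Set
Reflexible G r s pr ps =
  Σ (Automorphism G) λ α →
    (Automorphism.φ α r pr ≈ r ⁻¹) × (Automorphism.φ α s ps ≈ s ⁻¹)

Chiral : ∀ {k} (G : Perm k → Set) (r s : Perm k) → G r → G s → Set
Chiral G r s pr ps = ¬ Reflexible G r s pr ps

Fixed : ∀ {k} → Perm k → Fin k → Set
Fixed g ζ = ζ ^ g ≡ ζ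

ChiralMap : ∀ {k} (s t : Perm k) → Set
ChiralMap s t = Chiral ⟨ s , t ⟩ (t · s ⁻¹) s (gen-mul gen-t (gen-inv gen-s)) gen-s

{-# OPTIONS --safe #-}
-- If M(G : r, s) were reflexible, the automorphism r ↦ r⁻¹, s ↦ s⁻¹ would be
-- conjugation by some π ∈ S_k, and ρ = π s then satisfies ρ⁻¹ s ρ = s⁻¹ and
-- ρ⁻¹ t ρ = t.  Such a ρ maps the fixed points of s^b t to those of s^-b t,
-- and x ↦ x t maps these back to fixed points of s^b t, both maps preserving
-- "not fixed by t"; uniqueness in (i) therefore forces ζ ρ = ζ t.  Hence ρ
-- maps ζ s^c t to ζ t s^-c t while preserving fixedness by s and by s²,
-- contradicting (ii).
module Submission where

open import Defs
open import Data.Nat using (ℕ; zero; suc)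
open import Data.Integer using (ℤ; -_; 0ℤ; +_; -[1+_])
open import Data.Integer.Properties using (neg-involutive)
open import Data.Fin using (Fin)
open import Data.Fin.Permutation using (_≈_; id; inverseˡ; inverseʳ)
open import Data.Product using (Σ; _×_; _,_)
open import Function using (_∘_)
open import Data.Sum using (_⊎_; [_,_])
open import Relation.Binary.PropositionalEquality
  using (_≡_; _≢_; refl; sym; trans; cong; subst; module ≡-Reasoning)
open import Relation.Nullary using (¬_)
open ≡-Reasoning

private variable
  k : ℕ
  a a′ b b′ c g π ρ σ s t : Perm k
  x y : Fin k

involution-⁻¹ : t · t ≈ id → t ⁻¹ ≈ t
involution-⁻¹ {t = t} t²≈id y = begin
  y ^ t ⁻¹          ≡⟨ cong (_^ t ⁻¹) (sym (t²≈id y)) ⟩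
  y ^ t ^ t ^ t ⁻¹  ≡⟨ inverseˡ t ⟩
  y ^ t             ∎

fixed-⁻¹ : Fixed (g ⁻¹) x → Fixed g x
fixed-⁻¹ {g = g} {x = x} fix = begin
  x ^ g          ≡⟨ cong (_^ g) (sym fix) ⟩
  x ^ g ⁻¹ ^ g   ≡⟨ inverseʳ g ⟩
  x              ∎

fixed-image : Fixed g (x ^ g) → Fixed g x
fixed-image {g = g} {x = x} fix = begin
  x ^ g              ≡⟨ sym (inverseˡ g) ⟩
  x ^ g ^ g ^ g ⁻¹   ≡⟨ cong (_^ g ⁻¹) fix ⟩
  x ^ g ^ g ⁻¹       ≡⟨ inverseˡ g ⟩
  x                  ∎

fixed-·-involution : t · t ≈ id → a · a′ ≈ id → Fixed (a · t) x → Fixed (a′ · t) (x ^ t)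
fixed-·-involution {t = t} {a = a} {a′ = a′} {x = x} t²≈id aa′≈id fix = begin
  x ^ t ^ a′ ^ t       ≡⟨ cong (λ z → z ^ a′ ^ t) xt≡xa ⟩
  x ^ a ^ a′ ^ t       ≡⟨ cong (_^ t) (aa′≈id x) ⟩
  x ^ t                ∎
  where
  xt≡xa : x ^ t ≡ x ^ a
  xt≡xa = begin
    x ^ t           ≡⟨ cong (_^ t) (sym fix) ⟩
    x ^ a ^ t ^ t   ≡⟨ t²≈id (x ^ a) ⟩
    x ^ a           ∎

powℕ-sucʳ : ∀ n → powℕ g (suc n) ≈ powℕ g n · g
powℕ-sucʳ         zero    y = refl
powℕ-sucʳ {g = g} (suc n) y = powℕ-sucʳ n (y ^ g)

powℕ-cancel : ∀ n → powℕ g n · powℕ (g ⁻¹) n ≈ id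
powℕ-cancel         zero    y = refl
powℕ-cancel {g = g} (suc n) y = begin
  y ^ powℕ g (suc n) ^ g ⁻¹ ^ powℕ (g ⁻¹) n  ≡⟨ cong (λ z → z ^ g ⁻¹ ^ powℕ (g ⁻¹) n) (powℕ-sucʳ n y) ⟩
  y ^ powℕ g n ^ g ^ g ⁻¹ ^ powℕ (g ⁻¹) n    ≡⟨ cong (_^ powℕ (g ⁻¹) n) (inverseˡ g) ⟩
  y ^ powℕ g n ^ powℕ (g ⁻¹) n               ≡⟨ powℕ-cancel n y ⟩
  y                                           ∎

-- The negative cases of these two lemmas use that (g ⁻¹) ⁻¹ reduces to g.
pow-cancel : ∀ c → pow g c · pow g (- c) ≈ id
pow-cancel         (+ zero)  = λ _ → refl
pow-cancel         (+ suc n) = powℕ-cancel (suc n)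
pow-cancel {g = g} -[1+ n ]  = powℕ-cancel {g = g ⁻¹} (suc n)

pow-⁻¹ : ∀ c → pow (g ⁻¹) c ≈ pow g (- c)
pow-⁻¹ (+ zero)  _ = refl
pow-⁻¹ (+ suc n) _ = refl
pow-⁻¹ -[1+ n ]  _ = refl

-- A record rather than a function type, so that ρ, a and b stay inferable.
record Intertwines (ρ a b : Perm k) : Set where
  constructor intertwines
  field
    intertwine : ∀ y → y ^ a ^ ρ ≡ y ^ ρ ^ b
open Intertwines

conjugate-intertwines : π ⁻¹ · a · π ≈ b → Intertwines π a b
conjugate-intertwines {π = π} {a = a} {b = b} conj .intertwine y = begin
  y ^ a ^ π               ≡⟨ cong (λ z → z ^ a ^ π) (sym (inverseˡ π)) ⟩
  y ^ π ^ π ⁻¹ ^ a ^ π    ≡⟨ conj (y ^ π) ⟩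
  y ^ π ^ b               ∎

intertwines-respˡ : a ≈ a′ → Intertwines ρ a b → Intertwines ρ a′ b
intertwines-respˡ {ρ = ρ} a≈a′ ρab .intertwine y =
  trans (cong (_^ ρ) (sym (a≈a′ y))) (ρab .intertwine y)

intertwines-respʳ : b ≈ b′ → Intertwines ρ a b → Intertwines ρ a b′
intertwines-respʳ {ρ = ρ} b≈b′ ρab .intertwine y = trans (ρab .intertwine y) (b≈b′ (y ^ ρ))

intertwines-· : Intertwines ρ a b → Intertwines ρ a′ b′ → Intertwines ρ (a · a′) (b · b′)
intertwines-· {ρ = ρ} {a = a} {b = b} {a′ = a′} {b′ = b′} ρab ρa′b′ .intertwine y = begin
  y ^ a ^ a′ ^ ρ    ≡⟨ ρa′b′ .intertwine (y ^ a) ⟩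
  y ^ a ^ ρ ^ b′    ≡⟨ cong (_^ b′) (ρab .intertwine y) ⟩
  y ^ ρ ^ b ^ b′    ∎

intertwines-⁻¹ : Intertwines ρ a b → Intertwines ρ (a ⁻¹) (b ⁻¹)
intertwines-⁻¹ {ρ = ρ} {a = a} {b = b} ρab .intertwine y = begin
  y ^ a ⁻¹ ^ ρ                ≡⟨ sym (inverseˡ b) ⟩
  y ^ a ⁻¹ ^ ρ ^ b ^ b ⁻¹     ≡⟨ cong (_^ b ⁻¹) (sym (ρab .intertwine (y ^ a ⁻¹))) ⟩
  y ^ a ⁻¹ ^ a ^ ρ ^ b ⁻¹     ≡⟨ cong (λ z → z ^ ρ ^ b ⁻¹) (inverseʳ a) ⟩
  y ^ ρ ^ b ⁻¹                ∎

intertwines-powℕ : Intertwines ρ a b → ∀ n → Intertwines ρ (powℕ a n) (powℕ b n)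
intertwines-powℕ ρab zero    = intertwines λ _ → refl
intertwines-powℕ ρab (suc n) = intertwines-· ρab (intertwines-powℕ ρab n)

intertwines-pow : Intertwines ρ a b → ∀ c → Intertwines ρ (pow a c) (pow b c)
intertwines-pow ρab (+ n)    = intertwines-powℕ ρab n
intertwines-pow ρab -[1+ n ] = intertwines-powℕ (intertwines-⁻¹ ρab) (suc n)

intertwines-∘ : Intertwines ρ a b → Intertwines σ b c → Intertwines (ρ · σ) a c
intertwines-∘ {ρ = ρ} {a = a} {b = b} {σ = σ} {c = c} ρab σbc .intertwine y = begin
  y ^ a ^ ρ ^ σ   ≡⟨ cong (_^ σ) (ρab .intertwine y) ⟩
  y ^ ρ ^ b ^ σ   ≡⟨ σbc .intertwine (y ^ ρ) ⟩
  y ^ ρ ^ σ ^ c   ∎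

intertwines-preserves-fixed : Intertwines ρ a b → Fixed a y → Fixed b (y ^ ρ)
intertwines-preserves-fixed {ρ = ρ} {a = a} {b = b} {y = y} ρab fix = begin
  y ^ ρ ^ b   ≡⟨ sym (ρab .intertwine y) ⟩
  y ^ a ^ ρ   ≡⟨ cong (_^ ρ) fix ⟩
  y ^ ρ       ∎

intertwines-reflects-fixed : Intertwines ρ a b → Fixed b (y ^ ρ) → Fixed a y
intertwines-reflects-fixed {ρ = ρ} {a = a} {b = b} {y = y} ρab fix = begin
  y ^ a                ≡⟨ sym (inverseˡ ρ) ⟩
  y ^ a ^ ρ ^ ρ ⁻¹     ≡⟨ cong (_^ ρ ⁻¹) (ρab .intertwine y) ⟩
  y ^ ρ ^ b ^ ρ ⁻¹     ≡⟨ cong (_^ ρ ⁻¹) fix ⟩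
  y ^ ρ ^ ρ ⁻¹         ≡⟨ inverseˡ ρ ⟩
  y                    ∎

intertwines-inverse-fixed : Intertwines ρ g (g ⁻¹) → Fixed g y → Fixed g (y ^ ρ)
intertwines-inverse-fixed {g = g} ρgg⁻¹ fix =
  fixed-⁻¹ {g = g} (intertwines-preserves-fixed ρgg⁻¹ fix)

reflection-conjugator : t · t ≈ id →
  π ⁻¹ · s · π ≈ s ⁻¹ → π ⁻¹ · (t · s ⁻¹) · π ≈ (t · s ⁻¹) ⁻¹ →
  Intertwines (π · s) s (s ⁻¹) × Intertwines (π · s) t t
reflection-conjugator {t = t} {π = π} {s = s} t²≈id s-inverted r-inverted =
  intertwines-∘ πs ss⁻¹ , intertwines-∘ πt st
  where
  πs : Intertwines π s (s ⁻¹)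
  πs = conjugate-intertwines s-inverted
  πr : Intertwines π (t · s ⁻¹) ((t · s ⁻¹) ⁻¹)
  πr = conjugate-intertwines {a = t · s ⁻¹} r-inverted
  ss⁻¹ : Intertwines s (s ⁻¹) (s ⁻¹)
  ss⁻¹ .intertwine y = trans (inverseʳ s) (sym (inverseˡ s))
  πt : Intertwines π t ((t · s ⁻¹) ⁻¹ · s ⁻¹)
  πt = intertwines-respˡ {a = t · s ⁻¹ · s} (λ _ → inverseʳ s) (intertwines-· πr πs)
  st : Intertwines s ((t · s ⁻¹) ⁻¹ · s ⁻¹) t
  st .intertwine y = trans (inverseʳ s) (involution-⁻¹ {t = t} t²≈id (y ^ s))

reflexible⇒reflection-conjugator : ∀ {k} {s t : Perm k} → t · t ≈ id →
  (∀ (α : Automorphism ⟨ s , t ⟩) → InducedByConjugation α) →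
  Reflexible ⟨ s , t ⟩ (t · s ⁻¹) s (gen-mul gen-t (gen-inv gen-s)) gen-s →
  Σ (Perm k) λ ρ → Intertwines ρ s (s ⁻¹) × Intertwines ρ t t
reflexible⇒reflection-conjugator {s = s} {t = t} t²≈id induced (α , αr , αs)
  with induced α
... | π , conj =
  π · s , reflection-conjugator {t = t} {π = π} {s = s} t²≈id
            (by-π {h = s ⁻¹} gen-s αs) (by-π {h = (t · s ⁻¹) ⁻¹} _ αr)
  where
  open Automorphism α using (φ)
  by-π : ∀ {g h} (p : ⟨ s , t ⟩ g) → φ g p ≈ h → π ⁻¹ · g · π ≈ h
  by-π p φg≈h y = trans (sym (conj _ p y)) (φg≈h y)

module _ {s t ρ : Perm k} (t²≈id : t · t ≈ id)
         (ρs : Intertwines ρ s (s ⁻¹)) (ρt : Intertwines ρ t t) where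

  intertwines-pow-· : ∀ c → Intertwines ρ (pow s c · t) (pow s (- c) · t)
  intertwines-pow-· c = intertwines-· {b = pow s (- c)} ρsᶜ ρt
    where
    ρsᶜ : Intertwines ρ (pow s c) (pow s (- c))
    ρsᶜ = intertwines-respʳ {b = pow (s ⁻¹) c} (pow-⁻¹ {g = s} c) (intertwines-pow ρs c)

  unique-point-image : ∀ {b ζ} → Fixed (pow s b · t) ζ → ¬ Fixed t ζ →
    (∀ ζ′ → Fixed (pow s b · t) ζ′ → ¬ Fixed t ζ′ → ζ′ ≡ ζ) → ζ ^ ρ ≡ ζ ^ t
  unique-point-image {b} {ζ} fix nfix unique = begin
    ζ ^ ρ           ≡⟨ sym (t²≈id (ζ ^ ρ)) ⟩
    ζ ^ ρ ^ t ^ t   ≡⟨ cong (_^ t) (unique (ζ ^ ρ ^ t) fixed nonfixed) ⟩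
    ζ ^ t           ∎
    where
    cancel : pow s (- b) · pow s b ≈ id
    cancel = subst (λ c → pow s (- b) · pow s c ≈ id) (neg-involutive b) (pow-cancel (- b))
    fixed : Fixed (pow s b · t) (ζ ^ ρ ^ t)
    fixed = fixed-·-involution {t = t} {a = pow s (- b)} {a′ = pow s b} t²≈id cancel
              (intertwines-preserves-fixed (intertwines-pow-· b) fix)
    nonfixed : ¬ Fixed t (ζ ^ ρ ^ t)
    nonfixed = nfix ∘ intertwines-reflects-fixed ρt ∘ fixed-image {g = t}

  reversed-point-fixed : ∀ {ζ} → ζ ^ ρ ≡ ζ ^ t → Intertwines ρ g (g ⁻¹) →
    ∀ c → Fixed g (ζ ^ (pow s c · t)) → Fixed g (ζ ^ (t · pow s (- c) · t))
  reversed-point-fixed {g = g} {ζ} ζρ≡ζt ρg c fix =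
    subst (Fixed g) image (intertwines-inverse-fixed ρg fix)
    where
    image : ζ ^ (pow s c · t) ^ ρ ≡ ζ ^ (t · pow s (- c) · t)
    image = trans (intertwines-pow-· c .intertwine ζ) (cong (_^ (pow s (- c) · t)) ζρ≡ζt)

lemma2p4 : ∀ {k} (s t : Perm k) (n m : ℕ) →
    Transitive ⟨ s , t ⟩ →
    HasOrder t 2 →
    HasOrder s n →
    HasOrder (s · t) m →
    (∀ (α : Automorphism ⟨ s , t ⟩) → InducedByConjugation α) →
    Σ ℤ (λ b → (b ≢ 0ℤ) × Σ (Fin k) (λ ζ →
      (Fixed (pow s b · t) ζ × ¬ Fixed t ζ) ×
      (∀ ζ′ → Fixed (pow s b · t) ζ′ → ¬ Fixed t ζ′ → ζ′ ≡ ζ) ×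
      Σ ℤ (λ c →
        (Fixed s (ζ ^ (pow s c · t)) × ¬ Fixed s (ζ ^ (t · pow s (- c) · t)))
        ⊎ (Fixed (s · s) (ζ ^ (pow s c · t)) × ¬ Fixed (s · s) (ζ ^ (t · pow s (- c) · t)))))) →
    ChiralMap s t
lemma2p4 s t _ _ _ (_ , t²≈id , _) _ _ induced
         (b , _ , ζ , (fix , nfix) , unique , c , witness) reflexible
  with reflexible⇒reflection-conjugator t²≈id induced reflexible
... | ρ , ρs , ρt = [ refute ρs , refute (intertwines-· ρs ρs) ] witness
  where
  ζρ≡ζt : ζ ^ ρ ≡ ζ ^ t
  ζρ≡ζt = unique-point-image t²≈id ρs ρt {b = b} fix nfix unique
  refute : ∀ {g} → Intertwines ρ g (g ⁻¹) →
    ¬ (Fixed g (ζ ^ (pow s c · t)) × ¬ Fixed g (ζ ^ (t · pow s (- c) · t)))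
  refute {g} ρg (fixed , nonfixed) =
    nonfixed (reversed-point-fixed t²≈id ρs ρt {g = g} ζρ≡ζt ρg c fixed)
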